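{- Let $R,S$ be finite digraphs, let $\mathfrak{D}'$ be a class of finite digraphs, and let $\mathcal{E}(R),\mathcal{E}(S)$, $\phi_R,\phi_S$, $\alpha^R,\alpha^S$ be as in the context. Assume that ERD and AID hold. Let $\rho$ be an S-scheme from $R$ to $S$ with respect to $\mathfrak{D}'$, and put $\epsilon:=\alpha^S_{\mathcal{E}(R),\,\rho_{\mathcal{E}(R)}(\phi_R)}$. (1) The following are equivalent: - $\rho$ is induced by $\epsilon$ and $\epsilon$ fulfills Condition 1; - for all $G,H\in\mathfrak{D}'$, $\xi\in\mathcal{S}(G,R)$, $\zeta\in\mathcal{S}(H,R)$, $v\in V(G)$, $w\in V(H)$: $$\alpha^R_{G,\xi}(v)=\alpha^R_{H,\zeta}(w)\ \Longrightarrow\ \alpha^S_{G,\rho_G(\xi)}(v)=\alpha^S_{H,\rho_H(\zeta)}(w).\qquad(\ast\ast)$$ (2) Suppose that $\rho$ is induced by $\epsilon$, that $\epsilon$ fulfills Condition 1, and that for all $\mathfrak{a},\mathfrak{b}\in\mathcal{E}_o(R)$, $\epsilon(\mathfrak{a})=\epsilon(\mathfrak{b})$ implies $\phi_R(\mathfrak{a})=\phi_R(\mathfrak{b})$. Then $\rho$ is a strong S-scheme satisfying $(\ast\ast)$. (3) Suppose the hypotheses of (2) hold and, in addition, one of the following holds: - $\mathfrak{D}'=\mathfrak{D}$ and $R\in\mathfrak{D}$; - $\mathfrak{T}_a\subseteq\mathfrak{D}'\subseteq\mathfrak{D}$ and $R\in\mathfrak{T}_a$; - $\mathfrak{D}'=\mathfrak{P}$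 and $R\in\mathfrak{P}$; - $\mathfrak{D}'=\mathfrak{P}^*$ and $R\in\mathfrak{P}^*$. Then $\rho$ can be extended to a strong $\Gamma$-scheme $\rho'$ from $R$ to $S$ with respect to $\mathfrak{D}'$, meaning that $\rho'_G$ restricted to $\mathcal{S}(G,R)$ (with codomain $\mathcal{S}(G,S)$) equals $\rho_G$ for all $G\in\mathfrak{D}'$.
   Context: Digraphs $G=(V(G),A(G))$ have a finite nonempty vertex set and $A(G)\subseteq V(G)\times V(G)$; loops are allowed, and $vw$ denotes $(v,w)$. An arc $vw$ is proper if $v\ne w$, and $G^*$ is $G$ with all loops removed. A homomorphism $\xi:G\to H$ is a map with $\xi(v)\xi(w)\in A(H)$ for all $vw\in A(G)$. It is strict if, in addition, it maps proper arcs to proper arcs. $\mathcal{H}(G,H)$ and $\mathcal{S}(G,H)$ denote the sets of homomorphisms and of strict homomorphisms. Classes of digraphs: - $\mathfrak{D}$ is a representative system of the isomorphism classes of finite digraphs; $\mathfrak{D}'\subseteq\mathfrak{D}$, and constructed digraphs are tacitly identified with their representatives. - $\mathfrak{T}_a=\{G\in\mathfrak{D}: G^*\text{ has no closed walk}\}$. A closed walk is $v_0,\dots,v_I$ with $I\ge1$, $v_{i-1}v_i\in A$ for all $i$, and $v_0=v_I$. - $\mathfrak{P}$ is the set of posets in $\mathfrak{D}$, i.e. reflexive, antisymmetric, transitive digraphs. - $\mathfrak{P}^*=\{P^*:P\in\mathfrak{P}\}$. Schemes: - An S-scheme from $R$ to $S$ with respect to $\mathfrak{D}'$ is a family $\rho=(\rho_G)_{G\in\mathfrak{D}'}$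 of maps $\rho_G:\mathcal{S}(G,R)\to\mathcal{S}(G,S)$. It is strong if every $\rho_G$ is injective. - A Hom-scheme is a family of maps $\rho'_G:\mathcal{H}(G,R)\to\mathcal{H}(G,S)$, $G\in\mathfrak{D}'$, and is strong if every $\rho'_G$ is injective. - A Hom-scheme is a $\Gamma$-scheme if $\Gamma_\xi(v)=\Gamma_{\rho'_G(\xi)}(v)$ for all $G\in\mathfrak{D}'$, $\xi\in\mathcal{H}(G,R)$, $v\in V(G)$. Here $\Gamma_\xi(v)$ denotes the connectivity component of $v$ in the subdigraph of $G$ induced on $\xi^{ -1}(\xi(v))$. Auxiliary data: - $\mathcal{E}(R),\mathcal{E}(S)$ are finite digraphs with vertex sets $\mathcal{E}_o(R),\mathcal{E}_o(S)$. - $\phi_R\in\mathcal{S}(\mathcal{E}(R),R)$ and $\phi_S\in\mathcal{S}(\mathcal{E}(S),S)$. - $\alpha^R$ is an S-scheme from $R$ to $\mathcal{E}(R)$ with $\phi_R\circ\alpha^R_{G,\xi}=\xi$ for all $G\in\mathfrak{D}'$ and $\xi\in\mathcal{S}(G,R)$. - $\alpha^S$ is an S-scheme from $S$ to $\mathcal{E}(S)$ with $\phi_S\circ\alpha^S_{G,\zeta}=\zeta$ for all $G\in\mathfrak{D}'$ and $\zeta\in\mathcal{S}(G,S)$. Induced schemes and conditions: - For a strict homomorphism $\epsilon:\mathcal{E}(R)\to\mathcal{E}(S)$, put $\eta_G(\xi)=\phi_S\circ\epsilon\circ\alpha^R_{G,\xi}$. $\rho$ is induced by $\epsilon$ if $\rho_G(\xi)=\eta_G(\xi)$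 for all $G\in\mathfrak{D}'$ and $\xi\in\mathcal{S}(G,R)$. - $\epsilon$ fulfills Condition 1 if $\alpha^S_{G,\eta_G(\xi)}=\epsilon\circ\alpha^R_{G,\xi}$ for all $G\in\mathfrak{D}'$ and $\xi\in\mathcal{S}(G,R)$. - ERD means $\mathcal{E}(R)\in\mathfrak{D}'$. AID means that ERD holds and $\alpha^R_{\mathcal{E}(R),\phi_R}=\mathrm{id}_{\mathcal{E}_o(R)}$. -}

module Defs where

open import Data.Nat using (ℕ; suc)
open import Data.Fin using (Fin) renaming (_≟_ to _≟ᶠ_)
open import Data.Vec using (Vec; lookup; tabulate)
open import Data.Vec.Properties using (lookup∘tabulate)
open import Data.Bool using (Bool; T; _∧_; not)
open import Data.Product using (Σ; _×_; _,_; ∃)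
open import Data.Sum using (_⊎_)
open import Data.Empty using (⊥)
open import Relation.Nullary using (¬_; does)
open import Relation.Binary.PropositionalEquality
  using (_≡_; _≢_; refl; sym; trans; subst₂)
open import Function using (id)
open import Function.Bundles using (_⇔_)

record Digraph : Set where
  constructor mkDigraph
  field
    n   : ℕ                                  -- |V| = suc n  (nonempty)
    adj : Vec (Vec Bool (suc n)) (suc n)
open Digraph public

V : Digraph → Set
V G = Fin (suc (n G))

Arc : (G : Digraph) → V G → V G → Set
Arc G v w = T (lookup (lookup (adj G) v) w)

ProperArc : (G : Digraph) → V G → V G → Set
ProperArc G v w = Arc G v w × v ≢ w

strip : Digraph → Digraph
strip G = mkDigraph (n G)
  (tabulate λ v → tabulate λ w → lookup (lookup (adj G) v) w ∧ not (does (v ≟ᶠ w)))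

-- Maps between (finite) vertex sets are represented by their value
-- tables, so that equality of maps is propositional equality.

Map : Digraph → Digraph → Set
Map G H = Vec (V H) (suc (n G))

app : ∀ {a b} → Vec (Fin b) a → Fin a → Fin b
app f v = lookup f v

-- homomorphisms  (proof fields irrelevant: a homomorphism IS its map)
record Hom (G H : Digraph) : Set where
  constructor mkHom
  field
    map : Map G H
    .preserves : ∀ v w → Arc G v w → Arc H (app map v) (app map w)
open Hom public

record SHom (G H : Digraph) : Set where
  constructor mkSHom
  field
    smap : Map G H
    .spreserves : ∀ v w → Arc G v w → Arc H (app smap v) (app smap w)
    .sstrict : ∀ v w → Arc G v w → v ≢ w → app smap v ≢ app smap w
open SHom public

toHom : ∀ {G H} → SHom G H → Hom G H
toHom (mkSHom m p _) = mkHom m p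

idₛ : (G : Digraph) → SHom G G
idₛ G = mkSHom (tabulate id)
  (λ v w a → subst₂ (Arc G) (sym (lookup∘tabulate id v)) (sym (lookup∘tabulate id w)) a)
  (λ v w a ne e → ne (trans (sym (lookup∘tabulate id v)) (trans e (lookup∘tabulate id w))))

infixr 9 _∘ₛ_
_∘ₛ_ : ∀ {G H K} → SHom H K → SHom G H → SHom G K
_∘ₛ_ {G} {H} {K} (mkSHom g gp gs) (mkSHom f fp fs) =
  mkSHom (tabulate h)
    (λ v w a → subst₂ (Arc K) (sym (lookup∘tabulate h v)) (sym (lookup∘tabulate h w))
                 (gp _ _ (fp v w a)))
    (λ v w a ne e → gs _ _ (fp v w a) (fs v w a ne)
                 (trans (sym (lookup∘tabulate h v)) (trans e (lookup∘tabulate h w))))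
  where
  h : V G → V K
  h v = app g (app f v)

record _≅_ (G H : Digraph) : Set where
  field
    to      : V G → V H
    from    : V H → V G
    from∘to : ∀ v → from (to v) ≡ v
    to∘from : ∀ w → to (from w) ≡ w
    arcs    : ∀ v w → Arc G v w ⇔ Arc H (to v) (to w)

IsRepSystem : (Digraph → Set) → Set
IsRepSystem Rep =
  (∀ G → ∃ λ H → Rep H × (G ≅ H)) ×
  (∀ H H′ → Rep H → Rep H′ → H ≅ H′ → H ≡ H′)

data Walk⁺ (G : Digraph) : V G → V G → Set where
  edge : ∀ {v w} → ProperArc G v w → Walk⁺ G v w
  cons : ∀ {u v w} → ProperArc G u v → Walk⁺ G v w → Walk⁺ G u w

-- G* has no closed walk
Acyclic : Digraph → Set
Acyclic G = ∀ v → ¬ Walk⁺ G v v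

IsPoset : Digraph → Set
IsPoset G =
  (∀ v → Arc G v v) ×
  (∀ v w → Arc G v w → Arc G w v → v ≡ w) ×
  (∀ u v w → Arc G u v → Arc G v w → Arc G u w)

data ReachIn (G : Digraph) (P : V G → Set) (v : V G) : V G → Set where
  start : ReachIn G P v v
  step  : ∀ {u w} → ReachIn G P v u → (Arc G u w ⊎ Arc G w u) → P w →
          ReachIn G P v w

InΓ : ∀ {G R} → Hom G R → V G → V G → Set
InΓ {G} ξ v w = ReachIn G (λ x → app (map ξ) x ≡ app (map ξ) v) v w

SScheme : (Digraph → Set) → Digraph → Digraph → Set
SScheme 𝔇′ R S = ∀ G → .(𝔇′ G) → SHom G R → SHom G S

HomScheme : (Digraph → Set) → Digraph → Digraph → Set
HomScheme 𝔇′ R S = ∀ G → .(𝔇′ G) → Hom G R → Hom G S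

StrongS : ∀ {𝔇′ R S} → SScheme 𝔇′ R S → Set
StrongS {𝔇′} ρ = ∀ G → .(p : 𝔇′ G) → ∀ ξ ζ → ρ G p ξ ≡ ρ G p ζ → ξ ≡ ζ

StrongHom : ∀ {𝔇′ R S} → HomScheme 𝔇′ R S → Set
StrongHom {𝔇′} ρ = ∀ G → .(p : 𝔇′ G) → ∀ ξ ζ → ρ G p ξ ≡ ρ G p ζ → ξ ≡ ζ

IsΓScheme : ∀ {𝔇′ R S} → HomScheme 𝔇′ R S → Set
IsΓScheme {𝔇′} {R} ρ′ = ∀ G → .(p : 𝔇′ G) → (ξ : Hom G R) → ∀ v w →
  InΓ ξ v w ⇔ InΓ (ρ′ G p ξ) v w

Extends : ∀ {𝔇′ R S} → HomScheme 𝔇′ R S → SScheme 𝔇′ R S → Set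
Extends {𝔇′} {R} ρ′ ρ = ∀ G → .(p : 𝔇′ G) → (ξ : SHom G R) →
  ρ′ G p (toHom ξ) ≡ toHom (ρ G p ξ)

record Context : Set₁ where
  field
    Rep    : Digraph → Set
    isRep  : IsRepSystem Rep
    𝔇′     : Digraph → Set
    𝔇′⊆𝔇   : ∀ G → 𝔇′ G → Rep G
    R S    : Digraph
    ER ES  : Digraph
    φR     : SHom ER R
    φS     : SHom ES S
    αR     : SScheme 𝔇′ R ER
    αS     : SScheme 𝔇′ S ES
    αR-law : ∀ G → .(p : 𝔇′ G) → (ξ : SHom G R) → φR ∘ₛ αR G p ξ ≡ ξ
    αS-law : ∀ G → .(p : 𝔇′ G) → (ζ : SHom G S) → φS ∘ₛ αS G p ζ ≡ ζ

module _ (C : Context) where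
  open Context C

  -- AID (given ERD witnessed by d)
  AID : 𝔇′ ER → Set
  AID d = αR ER d φR ≡ idₛ ER

  module _ (d : 𝔇′ ER) (ρ : SScheme 𝔇′ R S) where

    ε : SHom ER ES
    ε = αS ER d (ρ ER d φR)

    η : SScheme 𝔇′ R S
    η G p ξ = φS ∘ₛ ε ∘ₛ αR G p ξ

    InducedByε : Set
    InducedByε = ∀ G → .(p : 𝔇′ G) → (ξ : SHom G R) → ρ G p ξ ≡ η G p ξ

    Condition1 : Set
    Condition1 = ∀ G → .(p : 𝔇′ G) → (ξ : SHom G R) →
      αS G p (η G p ξ) ≡ ε ∘ₛ αR G p ξ

    StarStar : Set
    StarStar = ∀ G H → .(p : 𝔇′ G) → .(q : 𝔇′ H) →
      (ξ : SHom G R) (ζ : SHom H R) (v : V G) (w : V H) →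
      app (smap (αR G p ξ)) v ≡ app (smap (αR H q ζ)) w →
      app (smap (αS G p (ρ G p ξ))) v ≡ app (smap (αS H q (ρ H q ζ))) w

    Hyp2 : Set
    Hyp2 = InducedByε × Condition1 ×
      (∀ a b → app (smap ε) a ≡ app (smap ε) b → app (smap φR) a ≡ app (smap φR) b)

  Case1 Case2 Case3 Case4 : Set
  Case1 = (∀ G → 𝔇′ G ⇔ Rep G) × Rep R
  Case2 = (∀ G → Rep G → Acyclic G → 𝔇′ G) × (Rep R × Acyclic R)
  Case3 = (∀ G → 𝔇′ G ⇔ (Rep G × IsPoset G)) × (Rep R × IsPoset R)
  Case4 = (∀ G → 𝔇′ G ⇔ InP* G) × InP* R
    where
    InP* : Digraph → Set
    InP* G = Rep G × ∃ λ P → Rep P × IsPoset P × (strip P ≅ G)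

-- Parts (1) and (2): under AID, condition (**) applied with H = 𝓔(R), ζ = φR and
-- w = αR_{G,ξ}(v) says exactly that αS ∘ ρ factors as ε ∘ αR; this factorisation
-- gives inducedness (apply φS and the law for αS) and Condition 1, and conversely.
-- If ε only identifies points with equal φR-image, the factorisation and the law
-- φR ∘ αR_{G,ξ} = ξ recover ξ from ρ_G(ξ).
--
-- Part (3): strict homomorphisms are sent by ρ. A non-strict ξ : G → R factors as
-- ξ = ξ̄ ∘ π through the quotient Q of G by the components Γ_ξ, with ξ̄ strict, and
-- ρ′_G(ξ) := ρ_Q(ξ̄) ∘ π. Because ρ_Q(ξ̄) is strict, ρ′_G(ξ) has the same fibre
-- components as ξ; these determine Q and π, so ρ′_G(ξ) determines ρ_Q(ξ̄), hence ξ̄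
-- and ξ. In each of the four cases Q lies in 𝔇′: it is the representative of its
-- isomorphism class, it is acyclic when R is (ξ̄ is strict), and in the poset case Q
-- is given the reflexive-transitive closure of the induced arcs. In the 𝔓* case R
-- is loopless, so there are no non-strict homomorphisms into R at all.
module Submission where

open import Defs
open import Data.Nat using (ℕ; zero; suc; _<_; _≤_)
open import Data.Nat.Properties using (≤-refl; m≤n⇒m≤1+n; <⇒≤; m<1+n⇒m<n∨m≡n)
open import Data.Fin using (Fin; zero; suc; toℕ; fromℕ<) renaming (_≟_ to _≟ᶠ_)
open import Data.Fin.Properties using (toℕ-fromℕ<; toℕ-injective; toℕ<n; any?)
open import Data.Bool using (Bool; true; false; T; _∧_; not)
open import Data.Bool.Properties using (T?; T-≡; ∧-zeroʳ) renaming (_≟_ to _≟ᵇ_)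
open import Data.Maybe using (Maybe; just; nothing; fromMaybe)
import Data.Maybe as Maybe
open import Data.Maybe.Properties using (just-injective)
open import Data.Vec using (Vec; lookup; tabulate)
open import Data.Vec.Properties using (lookup∘tabulate)
open import Data.Vec.Relation.Binary.Pointwise.Extensional using (ext; Pointwise-≡⇒≡)
open import Data.Product using (Σ; _×_; _,_; proj₁; proj₂; ∃)
open import Data.Sum using (_⊎_; inj₁; inj₂; swap)
open import Data.Empty using (⊥-elim; ⊥-elim-irr)
open import Data.Unit using (⊤; tt)
open import Function using (_∘_)
open import Function.Bundles using (_⇔_; Equivalence; mk⇔)
import Function.Properties.Equivalence as ⇔
open import Relation.Nullary using (Dec; yes; no; ¬_; does; recompute)
open import Relation.Nullary.Decidable
  using (map′; _×-dec_; _⊎-dec_; ¬?; ⌊_⌋; dec-true; does-⇔; isYes≗does; toWitness; fromWitness)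
open import Relation.Binary.Structures using (IsEquivalence)
open import Relation.Binary.PropositionalEquality

Table : ℕ → Set
Table m = Vec (Vec Bool m) m

entry : ∀ {m} → Table m → Fin m → Fin m → Bool
entry t a b = lookup (lookup t a) b

tabulate² : ∀ {m} → (Fin m → Fin m → Bool) → Table m
tabulate² f = tabulate λ a → tabulate (f a)

entry-tabulate² : ∀ {m} (f : Fin m → Fin m → Bool) a b → entry (tabulate² f) a b ≡ f a b
entry-tabulate² f a b =
  trans (cong (λ row → lookup row b) (lookup∘tabulate (λ x → tabulate (f x)) a))
        (lookup∘tabulate (f a) b)

entry-ext : ∀ {m} {t t′ : Table m} → (∀ a b → entry t a b ≡ entry t′ a b) → t ≡ t′
entry-ext eq = Pointwise-≡⇒≡ (ext λ a → Pointwise-≡⇒≡ (ext (eq a)))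

isYes-⇔ : ∀ {A B : Set} → A ⇔ B → (a? : Dec A) (b? : Dec B) → ⌊ a? ⌋ ≡ ⌊ b? ⌋
isYes-⇔ A⇔B a? b? = trans (isYes≗does a?) (trans (does-⇔ A⇔B a? b?) (sym (isYes≗does b?)))

shom-ext : ∀ {G H} {f g : SHom G H} → (∀ v → app (smap f) v ≡ app (smap g) v) → f ≡ g
shom-ext {f = mkSHom m _ _} {mkSHom m′ _ _} eq with Pointwise-≡⇒≡ {xs = m} {m′} (ext eq)
... | refl = refl

hom-ext : ∀ {G H} {f g : Hom G H} → (∀ v → app (map f) v ≡ app (map g) v) → f ≡ g
hom-ext {f = mkHom m _} {mkHom m′ _} eq with Pointwise-≡⇒≡ {xs = m} {m′} (ext eq)
... | refl = refl

toHom-injective : ∀ {G H} {f g : SHom G H} → toHom f ≡ toHom g → f ≡ g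
toHom-injective {f = mkSHom _ _ _} {mkSHom _ _ _} refl = refl

app-∘ₛ : ∀ {G H K} (g : SHom H K) (f : SHom G H) v →
  app (smap (g ∘ₛ f)) v ≡ app (smap g) (app (smap f) v)
app-∘ₛ g f = lookup∘tabulate (λ x → app (smap g) (app (smap f) x))

app-idₛ : ∀ G v → app (smap (idₛ G)) v ≡ v
app-idₛ G = lookup∘tabulate (λ x → x)

arc? : ∀ G v w → Dec (Arc G v w)
arc? G v w = T? _

hom-arc : ∀ {G H} (h : Hom G H) {v w} → Arc G v w → Arc H (app (map h) v) (app (map h) w)
hom-arc (mkHom _ preserves) {v} {w} a = recompute (T? _) (preserves v w a)

shom-arc : ∀ {G H} (h : SHom G H) {v w} → Arc G v w → Arc H (app (smap h) v) (app (smap h) w)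
shom-arc h = hom-arc (toHom h)

shom-strict : ∀ {G H} (h : SHom G H) {v w} → Arc G v w → v ≢ w →
  app (smap h) v ≢ app (smap h) w
shom-strict (mkSHom _ _ strict) {v} {w} a v≢w eq = ⊥-elim-irr (strict v w a v≢w eq)

module _ {G R : Digraph} where

  IsStrict : Hom G R → Set
  IsStrict ξ = ∀ v w → Arc G v w → v ≢ w → app (map ξ) v ≢ app (map ξ) w

  Collapses : Hom G R → Set
  Collapses ξ = ∃ λ v → ∃ λ w → ProperArc G v w × app (map ξ) v ≡ app (map ξ) w

  strict-or-collapses : (ξ : Hom G R) → IsStrict ξ ⊎ Collapses ξ
  strict-or-collapses ξ with any? (λ v → any? λ w →
    (arc? G v w ×-dec ¬? (v ≟ᶠ w)) ×-dec (app (map ξ) v ≟ᶠ app (map ξ) w))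
  ... | yes collapse = inj₂ collapse
  ... | no ¬collapse = inj₁ λ v w a v≢w eq → ¬collapse (v , w , (a , v≢w) , eq)

  toSHom : (ξ : Hom G R) → IsStrict ξ → SHom G R
  toSHom (mkHom m preserves) strict = mkSHom m preserves (λ v w → strict v w)

  toHom∘toSHom : (ξ : Hom G R) (s : IsStrict ξ) → toHom (toSHom ξ s) ≡ ξ
  toHom∘toSHom (mkHom _ _) _ = refl

  toSHom∘toHom : (ξ : SHom G R) (s : IsStrict (toHom ξ)) → toSHom (toHom ξ) s ≡ ξ
  toSHom∘toHom (mkSHom _ _ _) _ = refl

  toHom-isStrict : (ξ : SHom G R) → IsStrict (toHom ξ)
  toHom-isStrict ξ v w = shom-strict ξ

strict-reflects-acyclic : ∀ {G R} → SHom G R → Acyclic R → Acyclic G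
strict-reflects-acyclic {G} {R} h acyclic v = acyclic _ ∘ walk
  where
  proper : ∀ {a b} → ProperArc G a b → ProperArc R (app (smap h) a) (app (smap h) b)
  proper (a , a≢b) = shom-arc h a , shom-strict h a a≢b
  walk : ∀ {a b} → Walk⁺ G a b → Walk⁺ R (app (smap h) a) (app (smap h) b)
  walk (edge a) = edge (proper a)
  walk (cons a w) = cons (proper a) (walk w)

Antisymmetric : Digraph → Set
Antisymmetric G = ∀ v w → Arc G v w → Arc G w v → v ≡ w

strict-reflects-antisymmetry : ∀ {G R} → SHom G R → Antisymmetric R → Antisymmetric G
strict-reflects-antisymmetry h antisym v w vw wv with v ≟ᶠ w
... | yes v≡w = v≡w
... | no v≢w = ⊥-elim (shom-strict h vw v≢w (antisym _ _ (shom-arc h vw) (shom-arc h wv)))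

strip-loopless : ∀ P x → ¬ Arc (strip P) x x
strip-loopless P x = subst T (begin
  entry (adj (strip P)) x x                 ≡⟨ entry-tabulate² (λ v w → entry (adj P) v w ∧ not (does (v ≟ᶠ w))) x x ⟩
  entry (adj P) x x ∧ not (does (x ≟ᶠ x))   ≡⟨ cong (λ b → entry (adj P) x x ∧ not b) (dec-true (x ≟ᶠ x) refl) ⟩
  entry (adj P) x x ∧ false                 ≡⟨ ∧-zeroʳ _ ⟩
  false                                     ∎)
  where open ≡-Reasoning

≅-loopless : ∀ {G H} → G ≅ H → (∀ x → ¬ Arc G x x) → ∀ y → ¬ Arc H y y
≅-loopless {G} {H} G≅H loopless y loop = loopless (from y)
  (Equivalence.from (arcs (from y) (from y))
    (subst₂ (Arc H) (sym (to∘from y)) (sym (to∘from y)) loop))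
  where open _≅_ G≅H

loopless⇒¬collapses : ∀ {G R} → (∀ r → ¬ Arc R r r) → (ξ : Hom G R) → ¬ Collapses ξ
loopless⇒¬collapses {R = R} loopless ξ (v , w , (a , _) , eq) =
  loopless _ (subst (Arc R _) (sym eq) (hom-arc ξ a))

-- Factorisation of αS ∘ ρ through ε

module InducedScheme (C : Context) (d : Context.𝔇′ C (Context.ER C))
                     (ρ : SScheme (Context.𝔇′ C) (Context.R C) (Context.S C)) where
  open Context C

  ε₀ : SHom ER ES
  ε₀ = ε C d ρ

  Factorises : Set
  Factorises = ∀ G → .(p : 𝔇′ G) → (ξ : SHom G R) → αS G p (ρ G p ξ) ≡ ε₀ ∘ₛ αR G p ξ

  factorises-at : Factorises → ∀ G .(p : 𝔇′ G) (ξ : SHom G R) v →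
    app (smap (αS G p (ρ G p ξ))) v ≡ app (smap ε₀) (app (smap (αR G p ξ)) v)
  factorises-at fact G p ξ v =
    trans (cong (λ h → app (smap h) v) (fact G p ξ)) (app-∘ₛ ε₀ (αR G p ξ) v)

  induced×condition1⇒factorises : InducedByε C d ρ × Condition1 C d ρ → Factorises
  induced×condition1⇒factorises (induced , condition1) G p ξ =
    trans (cong (αS G p) (induced G p ξ)) (condition1 G p ξ)

  factorises⇒induced×condition1 : Factorises → InducedByε C d ρ × Condition1 C d ρ
  factorises⇒induced×condition1 fact = induced , condition1
    where
    induced : InducedByε C d ρ
    induced G p ξ = trans (sym (αS-law G p (ρ G p ξ))) (cong (φS ∘ₛ_) (fact G p ξ))
    condition1 : Condition1 C d ρ
    condition1 G p ξ = trans (cong (αS G p) (sym (induced G p ξ))) (fact G p ξ)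

  factorises⇒starstar : Factorises → StarStar C d ρ
  factorises⇒starstar fact G H p q ξ ζ v w same = begin
    app (smap (αS G p (ρ G p ξ))) v           ≡⟨ factorises-at fact G p ξ v ⟩
    app (smap ε₀) (app (smap (αR G p ξ)) v)   ≡⟨ cong (app (smap ε₀)) same ⟩
    app (smap ε₀) (app (smap (αR H q ζ)) w)   ≡⟨ factorises-at fact H q ζ w ⟨
    app (smap (αS H q (ρ H q ζ))) w           ∎
    where open ≡-Reasoning

  starstar⇒factorises : AID C d → StarStar C d ρ → Factorises
  starstar⇒factorises aid starstar G p ξ = shom-ext λ v →
    trans (starstar G ER p d ξ φR v _ (αR-fixes _)) (sym (app-∘ₛ ε₀ (αR G p ξ) v))
    where
    αR-fixes : ∀ x → x ≡ app (smap (αR ER d φR)) x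
    αR-fixes x = sym (trans (cong (λ h → app (smap h) x) aid) (app-idₛ ER x))

  αR-law-at : ∀ G .(p : 𝔇′ G) (ξ : SHom G R) v →
    app (smap ξ) v ≡ app (smap φR) (app (smap (αR G p ξ)) v)
  αR-law-at G p ξ v = trans (cong (λ h → app (smap h) v) (sym (αR-law G p ξ))) (app-∘ₛ φR (αR G p ξ) v)

  hyp2⇒strong : Hyp2 C d ρ → StrongS ρ
  hyp2⇒strong (induced , condition1 , ε-reflects-φR) G p ξ ζ same = shom-ext λ v → begin
    app (smap ξ) v                            ≡⟨ αR-law-at G p ξ v ⟩
    app (smap φR) (app (smap (αR G p ξ)) v)   ≡⟨ ε-reflects-φR _ _ (ε-agrees v) ⟩
    app (smap φR) (app (smap (αR G p ζ)) v)   ≡⟨ αR-law-at G p ζ v ⟨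
    app (smap ζ) v                            ∎
    where
    open ≡-Reasoning
    fact : Factorises
    fact = induced×condition1⇒factorises (induced , condition1)
    ε-agrees : ∀ v → app (smap ε₀) (app (smap (αR G p ξ)) v) ≡ app (smap ε₀) (app (smap (αR G p ζ)) v)
    ε-agrees v = begin
      app (smap ε₀) (app (smap (αR G p ξ)) v)   ≡⟨ factorises-at fact G p ξ v ⟨
      app (smap (αS G p (ρ G p ξ))) v           ≡⟨ cong (λ h → app (smap (αS G p h)) v) same ⟩
      app (smap (αS G p (ρ G p ζ))) v           ≡⟨ factorises-at fact G p ζ v ⟩
      app (smap ε₀) (app (smap (αR G p ζ)) v)   ∎

-- Decidable reachability (Warshall's algorithm)

module Warshall {N : ℕ} (E : Fin N → Fin N → Set) (E? : ∀ x y → Dec (E x y)) where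

  data Reach (x : Fin N) : Fin N → Set where
    start : Reach x x
    step  : ∀ {u y} → Reach x u → E u y → Reach x y

  reach-trans : ∀ {x y z} → Reach x y → Reach y z → Reach x z
  reach-trans p start = p
  reach-trans p (step q e) = step (reach-trans p q) e

  Allowed : ℕ → Fin N → Fin N → Set
  Allowed k x u = u ≡ x ⊎ toℕ u < k

  data ReachBelow (k : ℕ) (x : Fin N) : Fin N → Set where
    start′ : ReachBelow k x x
    step′  : ∀ {u y} → ReachBelow k x u → Allowed k x u → E u y → ReachBelow k x y

  forget : ∀ {k x y} → ReachBelow k x y → Reach x y
  forget start′ = start
  forget (step′ p _ e) = step (forget p) e

  reachBelow-N : ∀ {x y} → Reach x y → ReachBelow N x y
  reachBelow-N start = start′
  reachBelow-N (step p e) = step′ (reachBelow-N p) (inj₂ (toℕ<n _)) e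

  reachBelow-suc : ∀ {k x y} → ReachBelow k x y → ReachBelow (suc k) x y
  reachBelow-suc start′ = start′
  reachBelow-suc (step′ p (inj₁ u≡x) e) = step′ (reachBelow-suc p) (inj₁ u≡x) e
  reachBelow-suc (step′ p (inj₂ u<k) e) = step′ (reachBelow-suc p) (inj₂ (m≤n⇒m≤1+n u<k)) e

  reachBelow-++ : ∀ {k x z y} → ReachBelow k x z → Allowed k x z → ReachBelow k z y → ReachBelow k x y
  reachBelow-++ p z-ok start′ = p
  reachBelow-++ p z-ok (step′ q (inj₁ refl) e) = step′ (reachBelow-++ p z-ok q) z-ok e
  reachBelow-++ p z-ok (step′ q (inj₂ u<k) e) = step′ (reachBelow-++ p z-ok q) (inj₂ u<k) e

  reachBelow-zero⇒ : ∀ {x y} → ReachBelow 0 x y → x ≡ y ⊎ E x y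
  reachBelow-zero⇒ start′ = inj₁ refl
  reachBelow-zero⇒ (step′ p (inj₁ refl) e) = inj₂ e

  reachBelow-zero⇐ : ∀ {x y} → x ≡ y ⊎ E x y → ReachBelow 0 x y
  reachBelow-zero⇐ (inj₁ refl) = start′
  reachBelow-zero⇐ (inj₂ e) = step′ start′ (inj₁ refl) e

  module _ (k : ℕ) (k<N : k < N) where

    pivot : Fin N
    pivot = fromℕ< k<N

    ViaPivot : Fin N → Fin N → Set
    ViaPivot x y = ReachBelow k x y ⊎ (ReachBelow k x pivot × ReachBelow k pivot y)

    index-pivot : ∀ {u} → toℕ u ≡ k → u ≡ pivot
    index-pivot eq = toℕ-injective (trans eq (sym (toℕ-fromℕ< k<N)))

    reachBelow-suc⇒ : ∀ {x y} → ReachBelow (suc k) x y → ViaPivot x y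
    reachBelow-suc⇒ start′ = inj₁ start′
    reachBelow-suc⇒ {x} (step′ {u} p u-ok e) with reachBelow-suc⇒ p | u ≟ᶠ x
    ... | inj₁ q | yes refl = inj₁ (step′ q (inj₁ refl) e)
    ... | inj₂ _ | yes refl = inj₁ (step′ start′ (inj₁ refl) e)
    ... | r | no u≢x with u-ok
    ...   | inj₁ u≡x = ⊥-elim (u≢x u≡x)
    ...   | inj₂ u<1+k with m<1+n⇒m<n∨m≡n u<1+k | r
    ...     | inj₁ u<k | inj₁ q = inj₁ (step′ q (inj₂ u<k) e)
    ...     | inj₁ u<k | inj₂ (q₁ , q₂) = inj₂ (q₁ , step′ q₂ (inj₂ u<k) e)
    ...     | inj₂ u≡k | inj₁ q =
      inj₂ (subst (ReachBelow k x) (index-pivot u≡k) q ,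
            step′ start′ (inj₁ refl) (subst (λ z → E z _) (index-pivot u≡k) e))
    ...     | inj₂ u≡k | inj₂ (q₁ , q₂) = inj₂ (q₁ , step′ q₂ (inj₁ (index-pivot u≡k)) e)

    reachBelow-suc⇐ : ∀ {x y} → ViaPivot x y → ReachBelow (suc k) x y
    reachBelow-suc⇐ (inj₁ q) = reachBelow-suc q
    reachBelow-suc⇐ (inj₂ (q₁ , q₂)) =
      reachBelow-++ (reachBelow-suc q₁)
        (inj₂ (subst (_< suc k) (sym (toℕ-fromℕ< k<N)) ≤-refl)) (reachBelow-suc q₂)

  reachBelow? : ∀ k → k ≤ N → ∀ x y → Dec (ReachBelow k x y)
  reachBelow? zero _ x y = map′ reachBelow-zero⇐ reachBelow-zero⇒ ((x ≟ᶠ y) ⊎-dec E? x y)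
  reachBelow? (suc k) k<N x y =
    map′ (reachBelow-suc⇐ k k<N) (reachBelow-suc⇒ k k<N)
      (below x y ⊎-dec (below x (pivot k k<N) ×-dec below (pivot k k<N) y))
    where
    below = reachBelow? k (<⇒≤ k<N)

  reach? : ∀ x y → Dec (Reach x y)
  reach? x y = map′ forget reachBelow-N (reachBelow? N ≤-refl x y)

first : ∀ {m} → (Fin m → Bool) → Maybe (Fin m)
first {zero} f = nothing
first {suc m} f with f zero
... | true = just zero
... | false = Maybe.map suc (first (f ∘ suc))

first-sound : ∀ {m} (f : Fin m → Bool) {i} → first f ≡ just i → f i ≡ true
first-sound {suc m} f eq with f zero in fzero
first-sound {suc m} f refl | true = fzero
... | false with first (f ∘ suc) in eq′
first-sound {suc m} f refl | false | just j = first-sound (f ∘ suc) eq′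

first-complete : ∀ {m} (f : Fin m → Bool) i → f i ≡ true → ∃ λ j → first f ≡ just j
first-complete {suc m} f i fi with f zero in fzero
... | true = zero , refl
first-complete {suc m} f zero fi | false with trans (sym fzero) fi
... | ()
first-complete {suc m} f (suc i) fi | false with first-complete (f ∘ suc) i fi
... | j , eq = suc j , cong (Maybe.map suc) eq

first-zero : ∀ {m} (f : Fin (suc m) → Bool) → f zero ≡ true → first f ≡ just zero
first-zero f fzero rewrite fzero = refl

first-cong : ∀ {m} {f g : Fin m → Bool} → (∀ i → f i ≡ g i) → first f ≡ first g
first-cong {zero} eq = refl
first-cong {suc m} {f} {g} eq with f zero | g zero | eq zero
... | true | .true | refl = refl
... | false | .false | refl = cong (Maybe.map suc) (first-cong (eq ∘ suc))

record Enumeration (N : ℕ) (D : Fin N → Set) : Set where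
  field
    size       : ℕ
    elem       : Fin size → Fin N
    elem-ok    : ∀ i → D (elem i)
    index      : ∀ x → .(D x) → Fin size
    elem-index : ∀ x .(d : D x) → elem (index x d) ≡ x
    index-elem : ∀ i .(d : D (elem i)) → index (elem i) d ≡ i

enumerate : ∀ N (D : Fin N → Set) → (∀ x → Dec (D x)) → Enumeration N D
enumerate zero D D? = record
  { size = 0 ; elem = λ () ; elem-ok = λ () ; index = λ () ; elem-index = λ () ; index-elem = λ () }
enumerate (suc N) D D? = extend (D? zero)
  where
  module Tail = Enumeration (enumerate N (D ∘ suc) (D? ∘ suc))

  extend : Dec (D zero) → Enumeration (suc N) D
  extend (yes d₀) = record
    { size = suc Tail.size ; elem = elem ; elem-ok = elem-ok ; index = index
    ; elem-index = elem-index ; index-elem = index-elem }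
    where
    elem : Fin (suc Tail.size) → Fin (suc N)
    elem zero = zero
    elem (suc i) = suc (Tail.elem i)
    elem-ok : ∀ i → D (elem i)
    elem-ok zero = d₀
    elem-ok (suc i) = Tail.elem-ok i
    index : ∀ x → .(D x) → Fin (suc Tail.size)
    index zero _ = zero
    index (suc x) d = suc (Tail.index x d)
    elem-index : ∀ x .(d : D x) → elem (index x d) ≡ x
    elem-index zero _ = refl
    elem-index (suc x) d = cong suc (Tail.elem-index x d)
    index-elem : ∀ i .(d : D (elem i)) → index (elem i) d ≡ i
    index-elem zero _ = refl
    index-elem (suc i) d = cong suc (Tail.index-elem i d)
  extend (no ¬d₀) = record
    { size = Tail.size ; elem = suc ∘ Tail.elem ; elem-ok = Tail.elem-ok ; index = index
    ; elem-index = elem-index ; index-elem = Tail.index-elem }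
    where
    index : ∀ x → .(D x) → Fin Tail.size
    index zero d = ⊥-elim-irr (¬d₀ d)
    index (suc x) d = Tail.index x d
    elem-index : ∀ x .(d : D x) → suc (Tail.elem (index x d)) ≡ x
    elem-index zero d = ⊥-elim-irr (¬d₀ d)
    elem-index (suc x) d = cong suc (Tail.elem-index x d)

module Fibre {G R : Digraph} (ξ : Hom G R) where

  private
    f : V G → V R
    f = app (map ξ)

    Link : V G → V G → V G → Set
    Link v u w = (Arc G u w ⊎ Arc G w u) × f w ≡ f v

    link? : ∀ v u w → Dec (Link v u w)
    link? v u w = (arc? G u w ⊎-dec arc? G w u) ×-dec (f w ≟ᶠ f v)

    toReach : ∀ {v w} → InΓ ξ v w → Warshall.Reach (Link v) (link? v) v w
    toReach start = Warshall.start
    toReach (step p a eq) = Warshall.step (toReach p) (a , eq)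

    fromReach : ∀ {v w} → Warshall.Reach (Link v) (link? v) v w → InΓ ξ v w
    fromReach Warshall.start = start
    fromReach (Warshall.step p (a , eq)) = step (fromReach p) a eq

  InΓ? : ∀ v w → Dec (InΓ ξ v w)
  InΓ? v w = map′ fromReach toReach (Warshall.reach? (Link v) (link? v) v w)

  Γ-fibre : ∀ {v w} → InΓ ξ v w → f w ≡ f v
  Γ-fibre start = refl
  Γ-fibre (step _ _ eq) = eq

  Γ-trans : ∀ {u v w} → InΓ ξ u v → InΓ ξ v w → InΓ ξ u w
  Γ-trans p start = p
  Γ-trans p (step q a eq) = step (Γ-trans p q) a (trans eq (Γ-fibre p))

  Γ-sym : ∀ {v w} → InΓ ξ v w → InΓ ξ w v
  Γ-sym start = start
  Γ-sym (step p a eq) = Γ-trans (step start (swap a) (trans (Γ-fibre p) (sym eq))) (Γ-sym p)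

  -- Abstract only so that type checking never unfolds the decision procedure.
  abstract
    Γ-table : Table (suc (n G))
    Γ-table = tabulate² λ v w → ⌊ InΓ? v w ⌋

    Γ-table-entry : ∀ v w → entry Γ-table v w ≡ ⌊ InΓ? v w ⌋
    Γ-table-entry = entry-tabulate² λ v w → ⌊ InΓ? v w ⌋

open Fibre using (InΓ?; Γ-fibre; Γ-trans; Γ-sym; Γ-table; Γ-table-entry)

Γ-table-≡ : ∀ {G R S} (ξ : Hom G R) (ζ : Hom G S) → (∀ v w → InΓ ξ v w ⇔ InΓ ζ v w) →
  Γ-table ξ ≡ Γ-table ζ
Γ-table-≡ ξ ζ same = entry-ext λ v w → begin
  entry (Γ-table ξ) v w  ≡⟨ Γ-table-entry ξ v w ⟩
  ⌊ InΓ? ξ v w ⌋         ≡⟨ isYes-⇔ (same v w) (InΓ? ξ v w) (InΓ? ζ v w) ⟩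
  ⌊ InΓ? ζ v w ⌋         ≡⟨ Γ-table-entry ζ v w ⟨
  entry (Γ-table ζ) v w  ∎
  where open ≡-Reasoning

strict⇒Γ-trivial : ∀ {G R} (ξ : Hom G R) → IsStrict ξ → ∀ {v w} → InΓ ξ v w → v ≡ w
strict⇒Γ-trivial ξ strict start = refl
strict⇒Γ-trivial ξ strict (step {u} {w} p a eq) with strict⇒Γ-trivial ξ strict p | u ≟ᶠ w
... | refl | yes u≡w = u≡w
... | refl | no u≢w with a
...   | inj₁ uw = ⊥-elim (strict _ _ uw u≢w (sym eq))
...   | inj₂ wu = ⊥-elim (strict _ _ wu (u≢w ∘ sym) eq)

strict-Γ⇔ : ∀ {G R S} (ξ : Hom G R) (ζ : Hom G S) → IsStrict ξ → IsStrict ζ →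
  ∀ v w → InΓ ξ v w ⇔ InΓ ζ v w
strict-Γ⇔ ξ ζ sξ sζ v w = mk⇔
  (λ p → subst (InΓ ζ v) (strict⇒Γ-trivial ξ sξ p) start)
  (λ p → subst (InΓ ξ v) (strict⇒Γ-trivial ζ sζ p) start)

strict≢collapsing : ∀ {G R S} (ξ : Hom G R) (ζ : Hom G S) → IsStrict ξ → Collapses ζ →
  ¬ (∀ v w → InΓ ξ v w ⇔ InΓ ζ v w)
strict≢collapsing ξ ζ strict (v , w , (a , v≢w) , eq) same =
  v≢w (strict⇒Γ-trivial ξ strict (Equivalence.from (same v w) (step start (inj₁ a) (sym eq))))

-- Quotients by an equivalence relation given as a table

data ArcRule : Set where
  adjacent closure : ArcRule

Admissible : ArcRule → Digraph → Set
Admissible adjacent R = ⊤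
Admissible closure R = IsPoset R

-- The quotient depends on the relation only through its table, so homomorphisms with the
-- same fibre components yield literally the same quotient digraph.
module Quotient (Rep : Digraph → Set) (isRep : IsRepSystem Rep) (rule : ArcRule)
                (G : Digraph) (tbl : Table (suc (n G))) where

  _~_ : V G → V G → Set
  v ~ w = entry tbl v w ≡ true

  rep : V G → V G
  rep v = fromMaybe v (first (entry tbl v))

  IsRep : V G → Set
  IsRep x = rep x ≡ x

  module _ (E : IsEquivalence _~_) where
    open IsEquivalence E using () renaming (refl to ~-refl; sym to ~-sym; trans to ~-trans)

    rep-first : ∀ v → first (entry tbl v) ≡ just (rep v)
    rep-first v with first (entry tbl v) | first-complete (entry tbl v) v (~-refl {v})
    ... | just _ | _ = refl
    ... | nothing | _ , ()

    ~rep : ∀ v → v ~ rep v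
    ~rep v = first-sound (entry tbl v) (rep-first v)

    rows-agree : ∀ {v v′} → v ~ v′ → ∀ w → entry tbl v w ≡ entry tbl v′ w
    rows-agree {v} {v′} v~v′ w with entry tbl v w in e | entry tbl v′ w in e′
    ... | true | true = refl
    ... | false | false = refl
    ... | true | false = sym (trans (sym e′) (~-trans (~-sym v~v′) e))
    ... | false | true = trans (sym e) (~-trans v~v′ e′)

    rep-resp : ∀ {v w} → v ~ w → rep v ≡ rep w
    rep-resp {v} {w} v~w = just-injective (begin
      just (rep v)         ≡⟨ rep-first v ⟨
      first (entry tbl v)  ≡⟨ first-cong (rows-agree v~w) ⟩
      first (entry tbl w)  ≡⟨ rep-first w ⟩
      just (rep w)         ∎)
      where open ≡-Reasoning

    rep-idem : ∀ v → IsRep (rep v)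
    rep-idem v = rep-resp (~-sym (~rep v))

    rep-reflects : ∀ {v w} → rep v ≡ rep w → v ~ w
    rep-reflects {v} {w} eq = ~-trans (~rep v) (subst (_~ w) (sym eq) (~-sym (~rep w)))

    reps-≡ : ∀ {v w} → IsRep v → IsRep w → v ~ w → v ≡ w
    reps-≡ rv rw v~w = trans (sym rv) (trans (rep-resp v~w) rw)

    rep-zero : IsRep zero
    rep-zero = cong (fromMaybe zero) (first-zero (entry tbl zero) (~-refl {zero}))

  module Reps = Enumeration (enumerate (n G) (IsRep ∘ suc) (λ x → rep (suc x) ≟ᶠ suc x))

  -- The vertex zero is always a representative, which keeps the quotient nonempty.

  fromQ₀ : Fin (suc Reps.size) → V G
  fromQ₀ zero = zero
  fromQ₀ (suc i) = suc (Reps.elem i)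

  indexQ₀ : ∀ x → .(IsRep x) → Fin (suc Reps.size)
  indexQ₀ zero _ = zero
  indexQ₀ (suc x) r = suc (Reps.index x r)

  fromQ₀-indexQ₀ : ∀ x .(r : IsRep x) → fromQ₀ (indexQ₀ x r) ≡ x
  fromQ₀-indexQ₀ zero _ = refl
  fromQ₀-indexQ₀ (suc x) r = cong suc (Reps.elem-index x r)

  indexQ₀-fromQ₀ : ∀ q .(r : IsRep (fromQ₀ q)) → indexQ₀ (fromQ₀ q) r ≡ q
  indexQ₀-fromQ₀ zero _ = refl
  indexQ₀-fromQ₀ (suc i) r = cong suc (Reps.index-elem i r)

  indexQ₀-cong : ∀ {x y} .(r : IsRep x) .(r′ : IsRep y) → x ≡ y → indexQ₀ x r ≡ indexQ₀ y r′
  indexQ₀-cong _ _ refl = refl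

  fromQ₀-isRep : IsEquivalence _~_ → ∀ q → IsRep (fromQ₀ q)
  fromQ₀-isRep E zero = rep-zero E
  fromQ₀-isRep E (suc i) = Reps.elem-ok i

  Linked : V G → V G → Set
  Linked x y = x ~ y ⊎ Arc G x y

  linked? : ∀ x y → Dec (Linked x y)
  linked? x y = (entry tbl x y ≟ᵇ true) ⊎-dec arc? G x y

  QArc : ArcRule → V G → V G → Set
  QArc adjacent A B = ∃ λ a → ∃ λ b → A ~ a × B ~ b × Arc G a b
  QArc closure A B = Warshall.Reach Linked linked? A B

  qArc? : ∀ r A B → Dec (QArc r A B)
  qArc? adjacent A B = any? λ a → any? λ b →
    (entry tbl A a ≟ᵇ true) ×-dec ((entry tbl B b ≟ᵇ true) ×-dec arc? G a b)
  qArc? closure A B = Warshall.reach? Linked linked? A B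

  Q₀ : Digraph
  Q₀ = mkDigraph Reps.size (tabulate² λ a b → ⌊ qArc? rule (fromQ₀ a) (fromQ₀ b) ⌋)

  Q : Digraph
  Q = proj₁ (proj₁ isRep Q₀)

  Q-rep : Rep Q
  Q-rep = proj₁ (proj₂ (proj₁ isRep Q₀))

  module σ = _≅_ (proj₂ (proj₂ (proj₁ isRep Q₀)))

  fromQ : V Q → V G
  fromQ q = fromQ₀ (σ.from q)

  toQ : .(IsEquivalence _~_) → V G → V Q
  toQ E v = σ.to (indexQ₀ (rep v) (rep-idem E v))

  arcQ₀⇔ : ∀ {x y} → Arc Q₀ x y ⇔ QArc rule (fromQ₀ x) (fromQ₀ y)
  arcQ₀⇔ {x} {y} = mk⇔
    (λ a → toWitness {a? = qArc? rule (fromQ₀ x) (fromQ₀ y)} (subst T (entry-tabulate² F x y) a))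
    (λ q → subst T (sym (entry-tabulate² F x y)) (fromWitness {a? = qArc? rule (fromQ₀ x) (fromQ₀ y)} q))
    where
    F : Fin (suc Reps.size) → Fin (suc Reps.size) → Bool
    F a b = ⌊ qArc? rule (fromQ₀ a) (fromQ₀ b) ⌋

  arcQ⇔ : ∀ {a b} → Arc Q a b ⇔ QArc rule (fromQ a) (fromQ b)
  arcQ⇔ {a} {b} = ⇔.trans (mk⇔
    (λ x → Equivalence.from (σ.arcs (σ.from a) (σ.from b))
             (subst₂ (Arc Q) (sym (σ.to∘from a)) (sym (σ.to∘from b)) x))
    (λ y → subst₂ (Arc Q) (σ.to∘from a) (σ.to∘from b)
             (Equivalence.to (σ.arcs (σ.from a) (σ.from b)) y)))
    arcQ₀⇔

  module _ (E : IsEquivalence _~_) where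
    open IsEquivalence E using () renaming (sym to ~-sym)

    fromQ-toQ : ∀ v → fromQ (toQ E v) ≡ rep v
    fromQ-toQ v = trans (cong fromQ₀ (σ.from∘to _)) (fromQ₀-indexQ₀ (rep v) (rep-idem E v))

    fromQ-isRep : ∀ q → IsRep (fromQ q)
    fromQ-isRep q = fromQ₀-isRep E (σ.from q)

    toQ-fromQ : ∀ q → toQ E (fromQ q) ≡ q
    toQ-fromQ q = trans (cong σ.to (trans
      (indexQ₀-cong (rep-idem E (fromQ q)) (fromQ-isRep q) (fromQ-isRep q))
      (indexQ₀-fromQ₀ (σ.from q) (fromQ-isRep q)))) (σ.to∘from q)

    fromQ-injective : ∀ {a b} → fromQ a ≡ fromQ b → a ≡ b
    fromQ-injective {a} {b} eq = trans (sym (toQ-fromQ a)) (trans (cong (toQ E) eq) (toQ-fromQ b))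

    toQ-resp : ∀ {v w} → v ~ w → toQ E v ≡ toQ E w
    toQ-resp {v} {w} v~w = cong σ.to (indexQ₀-cong (rep-idem E v) (rep-idem E w) (rep-resp E v~w))

    toQ-reflects : ∀ {v w} → toQ E v ≡ toQ E w → v ~ w
    toQ-reflects {v} {w} eq =
      rep-reflects E (trans (sym (fromQ-toQ v)) (trans (cong fromQ eq) (fromQ-toQ w)))

    qArc-rep : ∀ r {a b} → Arc G a b → QArc r (rep a) (rep b)
    qArc-rep adjacent {a} {b} x = a , b , ~-sym (~rep E a) , ~-sym (~rep E b) , x
    qArc-rep closure {a} {b} x = Warshall.step
      (Warshall.step (Warshall.step Warshall.start (inj₁ (~-sym (~rep E a)))) (inj₂ x))
      (inj₁ (~rep E b))

    toQ-arc : ∀ {a b} → Arc G a b → Arc Q (toQ E a) (toQ E b)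
    toQ-arc {a} {b} x = Equivalence.from arcQ⇔
      (subst₂ (QArc rule) (sym (fromQ-toQ a)) (sym (fromQ-toQ b)) (qArc-rep rule x))

  lift : ∀ {S} → .(IsEquivalence _~_) → SHom Q S → Hom G S
  lift {S} E ψ = mkHom (tabulate g)
    (λ a b x → subst₂ (Arc S) (sym (lookup∘tabulate g a)) (sym (lookup∘tabulate g b))
                 (shom-arc ψ (toQ-arc E x)))
    where
    g : V G → V S
    g v = app (smap ψ) (toQ E v)

  lift-app : ∀ {S} .(E : IsEquivalence _~_) (ψ : SHom Q S) v →
    app (map (lift E ψ)) v ≡ app (smap ψ) (toQ E v)
  lift-app E ψ = lookup∘tabulate (λ v → app (smap ψ) (toQ E v))

  lift-injective : ∀ {S} (E : IsEquivalence _~_) (ψ ψ′ : SHom Q S) → lift E ψ ≡ lift E ψ′ → ψ ≡ ψ′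
  lift-injective E ψ ψ′ eq = shom-ext λ q → begin
    app (smap ψ) q                      ≡⟨ cong (app (smap ψ)) (toQ-fromQ E q) ⟨
    app (smap ψ) (toQ E (fromQ q))      ≡⟨ lift-app E ψ (fromQ q) ⟨
    app (map (lift E ψ)) (fromQ q)      ≡⟨ cong (λ h → app (map h) (fromQ q)) eq ⟩
    app (map (lift E ψ′)) (fromQ q)     ≡⟨ lift-app E ψ′ (fromQ q) ⟩
    app (smap ψ′) (toQ E (fromQ q))     ≡⟨ cong (app (smap ψ′)) (toQ-fromQ E q) ⟩
    app (smap ψ′) q                     ∎
    where open ≡-Reasoning

  module Factor {R : Digraph} (ξ : Hom G R) (tbl≡ : tbl ≡ Γ-table ξ) where

    private
      f : V G → V R
      f = app (map ξ)

      entry≡ : ∀ v w → entry tbl v w ≡ ⌊ InΓ? ξ v w ⌋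
      entry≡ v w = trans (cong (λ t → entry t v w) tbl≡) (Γ-table-entry ξ v w)

    ~⇒Γ : ∀ {v w} → v ~ w → InΓ ξ v w
    ~⇒Γ {v} {w} v~w =
      toWitness {a? = InΓ? ξ v w} (Equivalence.from T-≡ (trans (sym (entry≡ v w)) v~w))

    Γ⇒~ : ∀ {v w} → InΓ ξ v w → v ~ w
    Γ⇒~ {v} {w} p = trans (entry≡ v w) (Equivalence.to T-≡ (fromWitness {a? = InΓ? ξ v w} p))

    E : IsEquivalence _~_
    E = record
      { refl  = Γ⇒~ start
      ; sym   = λ p → Γ⇒~ (Γ-sym ξ (~⇒Γ p))
      ; trans = λ p q → Γ⇒~ (Γ-trans ξ (~⇒Γ p) (~⇒Γ q))
      }
    open IsEquivalence E using () renaming (refl to ~-refl; sym to ~-sym; trans to ~-trans)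

    ~-fibre : ∀ {v w} → v ~ w → f v ≡ f w
    ~-fibre v~w = sym (Γ-fibre ξ (~⇒Γ v~w))

    arc-collapses : ∀ {a b} → Arc G a b → f a ≡ f b → a ~ b
    arc-collapses x eq = Γ⇒~ (step start (inj₁ x) (sym eq))

    closure-arc : IsPoset R → ∀ {A B} → Warshall.Reach Linked linked? A B → Arc R (f A) (f B)
    closure-arc (reflexive , _) Warshall.start = reflexive _
    closure-arc poset (Warshall.step p (inj₁ u~y)) = subst (Arc R _) (~-fibre u~y) (closure-arc poset p)
    closure-arc poset@(_ , _ , transitive) (Warshall.step p (inj₂ x)) =
      transitive _ _ _ (closure-arc poset p) (hom-arc ξ x)

    -- By antisymmetry of R the whole path stays in the fibre of A, so each step is inside Γ.
    closure-collapses : IsPoset R → ∀ {A B} → Warshall.Reach Linked linked? A B →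
      Arc R (f B) (f A) → A ~ B
    closure-collapses poset Warshall.start _ = ~-refl
    closure-collapses poset {A} (Warshall.step p (inj₁ u~y)) back =
      ~-trans (closure-collapses poset p (subst (λ z → Arc R z (f A)) (sym (~-fibre u~y)) back)) u~y
    closure-collapses poset@(_ , antisymmetric , transitive) {A} (Warshall.step {u} {y} p (inj₂ x)) back =
      ~-trans A~u (arc-collapses x (trans (sym fA≡fu) fA≡fy))
      where
      A~u : A ~ u
      A~u = closure-collapses poset p (transitive _ _ _ (hom-arc ξ x) back)
      fA≡fu : f A ≡ f u
      fA≡fu = ~-fibre A~u
      fA≡fy : f A ≡ f y
      fA≡fy = antisymmetric _ _ (subst (λ z → Arc R z (f y)) (sym fA≡fu) (hom-arc ξ x)) back

    qArc⇒arc : ∀ r → Admissible r R → ∀ {A B} → QArc r A B → Arc R (f A) (f B)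
    qArc⇒arc adjacent _ (a , b , A~a , B~b , x) =
      subst₂ (Arc R) (sym (~-fibre A~a)) (sym (~-fibre B~b)) (hom-arc ξ x)
    qArc⇒arc closure poset p = closure-arc poset p

    qArc-collapses : ∀ r → Admissible r R → ∀ {A B} → QArc r A B → f A ≡ f B → A ~ B
    qArc-collapses adjacent _ (a , b , A~a , B~b , x) eq =
      ~-trans A~a (~-trans (arc-collapses x (trans (sym (~-fibre A~a)) (trans eq (~-fibre B~b)))) (~-sym B~b))
    qArc-collapses closure poset@(reflexive , _) {A} p eq =
      closure-collapses poset p (subst (λ z → Arc R z (f A)) eq (reflexive _))

    ξ̄ : .(Admissible rule R) → SHom Q R
    ξ̄ ok = mkSHom (tabulate (f ∘ fromQ))
      (λ a b x → subst₂ (Arc R) (sym (ξ̄-app a)) (sym (ξ̄-app b))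
                   (qArc⇒arc rule ok (Equivalence.to (arcQ⇔ {a} {b}) x)))
      (λ a b x a≢b eq → a≢b (fromQ-injective E
         (reps-≡ E (fromQ-isRep E a) (fromQ-isRep E b)
           (qArc-collapses rule ok (Equivalence.to (arcQ⇔ {a} {b}) x) (trans (sym (ξ̄-app a)) (trans eq (ξ̄-app b)))))))
      where
      ξ̄-app : ∀ q → app (tabulate (f ∘ fromQ)) q ≡ f (fromQ q)
      ξ̄-app = lookup∘tabulate (f ∘ fromQ)

    ξ̄-toQ : .(ok : Admissible rule R) → ∀ v → app (smap (ξ̄ ok)) (toQ E v) ≡ f v
    ξ̄-toQ ok v = trans (lookup∘tabulate (f ∘ fromQ) (toQ E v))
                      (trans (cong f (fromQ-toQ E v)) (sym (~-fibre (~rep E v))))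

    quotient-isPoset : .(Admissible rule R) → Antisymmetric R →
      (∀ A → QArc rule A A) → (∀ {A B C} → QArc rule A B → QArc rule B C → QArc rule A C) →
      IsPoset Q
    quotient-isPoset ok antisymmetric qArc-refl qArc-trans =
      (λ q → Equivalence.from (arcQ⇔ {q} {q}) (qArc-refl _)) ,
      strict-reflects-antisymmetry (ξ̄ ok) antisymmetric ,
      λ a b c ab bc → Equivalence.from (arcQ⇔ {a} {c})
        (qArc-trans (Equivalence.to (arcQ⇔ {a} {b}) ab) (Equivalence.to (arcQ⇔ {b} {c}) bc))

    -- ψ is strict, so it identifies the ends of an arc of Q only if they coincide.
    lift-collapses : ∀ {S} (ψ : SHom Q S) {u w} → Arc G u w ⊎ Arc G w u →
      app (smap ψ) (toQ E u) ≡ app (smap ψ) (toQ E w) → u ~ w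
    lift-collapses ψ {u} {w} a eq = by-cases (toQ E u ≟ᶠ toQ E w) a
      where
      by-cases : Dec (toQ E u ≡ toQ E w) → Arc G u w ⊎ Arc G w u → u ~ w
      by-cases (yes same) _ = toQ-reflects E same
      by-cases (no differ) (inj₁ uw) =
        ⊥-elim (shom-strict ψ {toQ E u} {toQ E w} (toQ-arc E {u} {w} uw) differ eq)
      by-cases (no differ) (inj₂ wu) =
        ⊥-elim (shom-strict ψ {toQ E w} {toQ E u} (toQ-arc E {w} {u} wu) (differ ∘ sym) (sym eq))

    Γ-lift⇔ : ∀ {S} (ψ : SHom Q S) v w → InΓ ξ v w ⇔ InΓ (lift E ψ) v w
    Γ-lift⇔ {S} ψ v w = mk⇔ Γ⇒ Γ⇐
      where
      open ≡-Reasoning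
      ψ̂ : V G → V S
      ψ̂ = app (map (lift E ψ))

      Γ⇒ : ∀ {w} → InΓ ξ v w → InΓ (lift E ψ) v w
      Γ⇒ start = start
      Γ⇒ {w} (step p a eq) = step (Γ⇒ p) a (begin
        ψ̂ w                       ≡⟨ lift-app E ψ w ⟩
        app (smap ψ) (toQ E w)    ≡⟨ cong (app (smap ψ)) (toQ-resp E (Γ⇒~ (Γ-sym ξ (step p a eq)))) ⟩
        app (smap ψ) (toQ E v)    ≡⟨ lift-app E ψ v ⟨
        ψ̂ v                       ∎)

      Γ⇐ : ∀ {w} → InΓ (lift E ψ) v w → InΓ ξ v w
      Γ⇐ start = start
      Γ⇐ {w} (step {u} p a eq) = Γ-trans ξ (Γ⇐ p) (~⇒Γ (lift-collapses ψ a (begin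
        app (smap ψ) (toQ E u)    ≡⟨ lift-app E ψ u ⟨
        ψ̂ u                       ≡⟨ Γ-fibre (lift E ψ) p ⟩
        ψ̂ v                       ≡⟨ eq ⟨
        ψ̂ w                       ≡⟨ lift-app E ψ w ⟩
        app (smap ψ) (toQ E w)    ∎)))

  ξ̄-injective : ∀ {R} (ξ ζ : Hom G R) (pξ : tbl ≡ Γ-table ξ) (pζ : tbl ≡ Γ-table ζ)
    .(ok ok′ : Admissible rule R) → Factor.ξ̄ ξ pξ ok ≡ Factor.ξ̄ ζ pζ ok′ → ξ ≡ ζ
  ξ̄-injective ξ ζ pξ pζ ok ok′ eq = hom-ext λ v → begin
    app (map ξ) v                              ≡⟨ Factor.ξ̄-toQ ξ pξ ok v ⟨
    app (smap (Factor.ξ̄ ξ pξ ok)) (toQ Eξ v)   ≡⟨ cong (λ h → app (smap h) (toQ Eξ v)) eq ⟩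
    app (smap (Factor.ξ̄ ζ pζ ok′)) (toQ Eξ v)  ≡⟨ Factor.ξ̄-toQ ζ pζ ok′ v ⟩
    app (map ζ) v                              ∎
    where
    open ≡-Reasoning
    Eξ : IsEquivalence _~_
    Eξ = Factor.E ξ pξ

-- The extension ρ′ of a strong S-scheme

module QuotientBy (C : Context) (rule : ArcRule) {G : Digraph} (ξ : Hom G (Context.R C)) =
  Quotient (Context.Rep C) (Context.isRep C) rule G (Γ-table ξ)

module Extension (C : Context) (ρ : SScheme (Context.𝔇′ C) (Context.R C) (Context.S C))
  (ρ-strong : StrongS ρ) (rule : ArcRule) (admissible : Admissible rule (Context.R C))
  (quotient-closed : ∀ G → Context.𝔇′ C G → (ξ : Hom G (Context.R C)) → Collapses ξ →
     Context.𝔇′ C (QuotientBy.Q C rule ξ))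
  where
  open Context C
  module Q/ (G : Digraph) (tbl : Table (suc (n G))) = Quotient Rep isRep rule G tbl

  ρ̄ : ∀ G tbl (ξ : Hom G R) (tbl≡ : tbl ≡ Γ-table ξ) → .(𝔇′ (Q/.Q G tbl)) → SHom (Q/.Q G tbl) S
  ρ̄ G tbl ξ tbl≡ q = ρ (Q/.Q G tbl) q (Q/.Factor.ξ̄ G tbl ξ tbl≡ admissible)

  viaQuotient : ∀ G tbl (ξ : Hom G R) (tbl≡ : tbl ≡ Γ-table ξ) → .(𝔇′ (Q/.Q G tbl)) → Hom G S
  viaQuotient G tbl ξ tbl≡ q = Q/.lift G tbl (Q/.Factor.E G tbl ξ tbl≡) (ρ̄ G tbl ξ tbl≡ q)

  extend : ∀ G → .(𝔇′ G) → (ξ : Hom G R) → IsStrict ξ ⊎ Collapses ξ → Hom G S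
  extend G p ξ (inj₁ strict) = toHom (ρ G p (toSHom ξ strict))
  extend G p ξ (inj₂ collapse) = viaQuotient G (Γ-table ξ) ξ refl (quotient-closed G p ξ collapse)

  ρ′ : HomScheme 𝔇′ R S
  ρ′ G p ξ = extend G p ξ (strict-or-collapses ξ)

  extend-Γ⇔ : ∀ G .(p : 𝔇′ G) ξ c → ∀ v w → InΓ ξ v w ⇔ InΓ (extend G p ξ c) v w
  extend-Γ⇔ G p ξ (inj₁ strict) =
    strict-Γ⇔ ξ (toHom (ρ G p (toSHom ξ strict))) strict (toHom-isStrict (ρ G p (toSHom ξ strict)))
  extend-Γ⇔ G p ξ (inj₂ collapse) =
    Q/.Factor.Γ-lift⇔ G (Γ-table ξ) ξ refl (ρ̄ G (Γ-table ξ) ξ refl (quotient-closed G p ξ collapse))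

  extend-same-Γ : ∀ G .(p : 𝔇′ G) ξ ζ cξ cζ → extend G p ξ cξ ≡ extend G p ζ cζ →
    ∀ v w → InΓ ξ v w ⇔ InΓ ζ v w
  extend-same-Γ G p ξ ζ cξ cζ eq v w = ⇔.trans
    (subst (λ h → InΓ ξ v w ⇔ InΓ h v w) eq (extend-Γ⇔ G p ξ cξ v w))
    (⇔.sym (extend-Γ⇔ G p ζ cζ v w))

  viaQuotient-injective : ∀ G {tbl tbl′} → tbl ≡ tbl′ → (ξ ζ : Hom G R)
    (pξ : tbl ≡ Γ-table ξ) (pζ : tbl′ ≡ Γ-table ζ) .(q : 𝔇′ (Q/.Q G tbl)) .(q′ : 𝔇′ (Q/.Q G tbl′)) →
    viaQuotient G tbl ξ pξ q ≡ viaQuotient G tbl′ ζ pζ q′ → ξ ≡ ζ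
  viaQuotient-injective G {tbl} refl ξ ζ pξ pζ q q′ eq =
    Q/.ξ̄-injective G tbl ξ ζ pξ pζ admissible admissible
      (ρ-strong (Q/.Q G tbl) q _ _ (Q/.lift-injective G tbl (Q/.Factor.E G tbl ξ pξ) _ _ eq))

  extend-injective : ∀ G .(p : 𝔇′ G) ξ ζ cξ cζ → extend G p ξ cξ ≡ extend G p ζ cζ → ξ ≡ ζ
  extend-injective G p ξ ζ (inj₁ sξ) (inj₁ sζ) eq = begin
    ξ                      ≡⟨ toHom∘toSHom ξ sξ ⟨
    toHom (toSHom ξ sξ)    ≡⟨ cong toHom (ρ-strong G p _ _ (toHom-injective eq)) ⟩
    toHom (toSHom ζ sζ)    ≡⟨ toHom∘toSHom ζ sζ ⟩
    ζ                      ∎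
    where open ≡-Reasoning
  extend-injective G p ξ ζ (inj₁ sξ) (inj₂ cζ) eq =
    ⊥-elim (strict≢collapsing ξ ζ sξ cζ (extend-same-Γ G p ξ ζ (inj₁ sξ) (inj₂ cζ) eq))
  extend-injective G p ξ ζ (inj₂ cξ) (inj₁ sζ) eq =
    ⊥-elim (strict≢collapsing ζ ξ sζ cξ λ v w → ⇔.sym (extend-same-Γ G p ξ ζ (inj₂ cξ) (inj₁ sζ) eq v w))
  extend-injective G p ξ ζ (inj₂ cξ) (inj₂ cζ) eq =
    viaQuotient-injective G (Γ-table-≡ ξ ζ (extend-same-Γ G p ξ ζ (inj₂ cξ) (inj₂ cζ) eq)) ξ ζ refl refl
      (quotient-closed G p ξ cξ) (quotient-closed G p ζ cζ) eq

  extends : Extends ρ′ ρ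
  extends G p ξ with strict-or-collapses (toHom ξ)
  ... | inj₁ strict = cong (toHom ∘ ρ G p) (toSHom∘toHom ξ strict)
  ... | inj₂ (v , w , (a , v≢w) , eq) = ⊥-elim (shom-strict ξ a v≢w eq)

  Γ-extension : Σ (HomScheme 𝔇′ R S) λ ρ′ → StrongHom ρ′ × IsΓScheme ρ′ × Extends ρ′ ρ
  Γ-extension =
    ρ′ ,
    (λ G p ξ ζ → extend-injective G p ξ ζ (strict-or-collapses ξ) (strict-or-collapses ζ)) ,
    (λ G p ξ → extend-Γ⇔ G p ξ (strict-or-collapses ξ)) ,
    extends

Γ-extension : (C : Context) (ρ : SScheme (Context.𝔇′ C) (Context.R C) (Context.S C)) → StrongS ρ →
  Case1 C ⊎ Case2 C ⊎ Case3 C ⊎ Case4 C →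
  Σ (HomScheme (Context.𝔇′ C) (Context.R C) (Context.S C)) λ ρ′ →
    StrongHom ρ′ × IsΓScheme ρ′ × Extends ρ′ ρ
Γ-extension C ρ strong (inj₁ (𝔇′⇔Rep , _)) =
  Extension.Γ-extension C ρ strong adjacent tt λ G _ ξ _ →
    Equivalence.from (𝔇′⇔Rep _) (QuotientBy.Q-rep C adjacent ξ)
Γ-extension C ρ strong (inj₂ (inj₁ (acyclic-closed , _ , acyclic-R))) =
  Extension.Γ-extension C ρ strong adjacent tt λ G _ ξ _ → let open QuotientBy C adjacent ξ in
    acyclic-closed Q Q-rep (strict-reflects-acyclic (Factor.ξ̄ ξ refl tt) acyclic-R)
Γ-extension C ρ strong (inj₂ (inj₂ (inj₁ (𝔇′⇔poset , _ , poset-R)))) =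
  Extension.Γ-extension C ρ strong closure poset-R λ G _ ξ _ → let open QuotientBy C closure ξ in
    Equivalence.from (𝔇′⇔poset Q)
      (Q-rep , Factor.quotient-isPoset ξ refl poset-R (proj₁ (proj₂ poset-R))
                 (λ _ → Warshall.start) (Warshall.reach-trans Linked linked?))
Γ-extension C ρ strong (inj₂ (inj₂ (inj₂ (_ , _ , P , _ , _ , P*≅R)))) =
  Extension.Γ-extension C ρ strong adjacent tt λ G _ ξ collapse →
    ⊥-elim (loopless⇒¬collapses (≅-loopless P*≅R (strip-loopless P)) ξ collapse)

theorem4 : (C : Context) → (d : Context.𝔇′ C (Context.ER C)) → AID C d →
    (ρ : SScheme (Context.𝔇′ C) (Context.R C) (Context.S C)) →
    ((InducedByε C d ρ × Condition1 C d ρ) ⇔ StarStar C d ρ)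
    × (Hyp2 C d ρ → StrongS ρ × StarStar C d ρ)
    × (Hyp2 C d ρ → (Case1 C ⊎ Case2 C ⊎ Case3 C ⊎ Case4 C) →
        Σ (HomScheme (Context.𝔇′ C) (Context.R C) (Context.S C)) λ ρ′ →
          StrongHom ρ′ × IsΓScheme ρ′ × Extends ρ′ ρ)
theorem4 C d aid ρ =
  mk⇔ (factorises⇒starstar ∘ induced×condition1⇒factorises)
      (factorises⇒induced×condition1 ∘ starstar⇒factorises aid) ,
  (λ h2@(induced , condition1 , _) →
     hyp2⇒strong h2 , factorises⇒starstar (induced×condition1⇒factorises (induced , condition1))) ,
  (λ h2 → Γ-extension C ρ (hyp2⇒strong h2))
  where open InducedScheme C d ρ
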